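{- Let $K$ be a finite field of characteristic $p$ and order $q$, and let $s$ be a positive integer with $\gcd(s,q-1)=1$. In the group algebra $L[K^\times]$ we have $W=\Psi\,\overline{\Psi^{(1/s)}}+K^\times$.
   Context: $\zeta=\exp(2\pi i/p)$, $\psi(x)=\zeta^{\mathrm{Tr}(x)}$ with $\mathrm{Tr}\colon K\to\mathbb{F}_p$ the absolute trace, $W_u=\sum_{x\in K}\psi(x^s-ux)$. $L=\mathbb{Q}(\zeta,\xi)$ with $\xi=\exp(2\pi i/(q-1))$, and $L[K^\times]$ is the group algebra with elements $\sum_{u\in K^\times}S_u[u]$, $S_u\in L$. $K^\times$ also denotes the element $\sum_{u\in K^\times}[u]$. For $S=\sum S_u[u]$: $\overline{S}=\sum_u\overline{S_u}[u^{ -1}]$ (complex conjugation on coefficients) and $S^{(t)}=\sum_u S_u[u^t]$ for $t\in\mathbb{Z}$. $\Psi=\sum_{u\in K^\times}\psi(u)[u]$, $W=\sum_{u\in K^\times}W_u[u]$, and $1/s$ is the inverse of $s$ modulo $q-1$. -}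

module Defs where

open import Level using (0ℓ)
open import Data.Nat as ℕ using (ℕ; zero; suc; NonZero)
open import Data.Nat.DivMod using (_mod_)
open import Data.Fin using (Fin; toℕ)
open import Data.Integer as ℤ using (ℤ)
open import Data.List using (List; []; _∷_; foldr; filter; upTo; allFin; length)
open import Data.List.Membership.Propositional using (_∈_)
open import Data.List.Relation.Unary.Unique.Propositional using (Unique)
open import Data.Product using (∃; _×_)
open import Relation.Nullary using (¬_; ¬?; does)
open import Relation.Binary.PropositionalEquality using (_≡_)
open import Relation.Binary.Definitions using (DecidableEquality)
open import Algebra.Structures using (IsCommutativeRing)
open import Data.Bool using (if_then_else_)

record FiniteField : Set₁ where
  infixl 6 _+_
  infixl 7 _*_
  field
    Carrier    : Set
    _+_ _*_    : Carrier → Carrier → Carrier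
    -_         : Carrier → Carrier
    0# 1#      : Carrier
    isCommutativeRing : IsCommutativeRing _≡_ _+_ _*_ -_ 0# 1#
    0≢1        : ¬ (0# ≡ 1#)
    inverse    : ∀ x → ¬ (x ≡ 0#) → ∃ λ y → x * y ≡ 1#
    _≟_        : DecidableEquality Carrier
    elements   : List Carrier
    complete   : ∀ x → x ∈ elements
    unique     : Unique elements

  order : ℕ
  order = length elements

  _·1 : ℕ → Carrier
  zero ·1 = 0#
  suc n ·1 = 1# + n ·1

  _^_ : Carrier → ℕ → Carrier
  x ^ zero = 1#
  x ^ suc n = x * (x ^ n)

  units : List Carrier
  units = filter (λ x → ¬? (x ≟ 0#)) elements

  headOr : ∀ {A : Set} → A → List A → A
  headOr d [] = d
  headOr d (x ∷ _) = x

  -- multiplicative inverse (found by search; 0 ↦ 0)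
  inv : Carrier → Carrier
  inv x = headOr 0# (filter (λ y → (x * y) ≟ 1#) elements)

-- ℤ[ζ] ⊆ L, ζ = exp(2πi/p), p prime, modelled as ℤ[C_p] = (Fin p → ℤ)
-- (a ↦ Σ_i a_i ζ^i) modulo its kernel, which for p prime is ℤ·(1,…,1).
module Cyclotomic (p : ℕ) .{{_ : NonZero p}} where

  Zζ : Set
  Zζ = Fin p → ℤ

  _≈ζ_ : Zζ → Zζ → Set
  a ≈ζ b = ∃ λ (c : ℤ) → ∀ i → a i ≡ b i ℤ.+ c

  zeroζ : Zζ
  zeroζ _ = ℤ.0ℤ

  _⊕_ : Zζ → Zζ → Zζ
  (a ⊕ b) i = a i ℤ.+ b i

  ζ^ : ℕ → Zζ
  ζ^ k i = if does (toℕ i ℕ.≟ toℕ (k mod p)) then ℤ.1ℤ else ℤ.0ℤ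

  sumFin : (Fin p → ℤ) → ℤ
  sumFin f = foldr (λ j acc → f j ℤ.+ acc) ℤ.0ℤ (allFin p)

  _⊗_ : Zζ → Zζ → Zζ
  (a ⊗ b) i = sumFin (λ j → a j ℤ.* b ((toℕ i ℕ.+ (p ℕ.∸ toℕ j)) mod p))

  conj : Zζ → Zζ
  conj a i = a ((p ℕ.∸ toℕ i) mod p)

-- The objects of the paper for a finite field K of characteristic p with
-- q = p^n (n is the degree over 𝔽_p).
module Setup (K : FiniteField) (p : ℕ) .{{_ : NonZero p}} (n : ℕ) where
  open FiniteField K
  open Cyclotomic p public

  Tr : Carrier → Carrier
  Tr x = foldr (λ i acc → (x ^ (p ℕ.^ i)) + acc) 0# (upTo n)

  trℕ : Carrier → ℕ
  trℕ x = headOr 0 (filter (λ k → (k ·1) ≟ Tr x) (upTo p))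

  ψ : Carrier → Zζ
  ψ x = ζ^ (trℕ x)

  sumK : (Carrier → Zζ) → Zζ
  sumK f = foldr (λ x acc → f x ⊕ acc) zeroζ elements

  sumK× : (Carrier → Zζ) → Zζ
  sumK× f = foldr (λ x acc → f x ⊕ acc) zeroζ units

  Wcoef : ℕ → Carrier → Zζ
  Wcoef s u = sumK (λ x → ψ ((x ^ s) + (- (u * x))))

  -- group algebra L[K^×] (restricted to ℤ[ζ] coefficients):
  -- an element is its coefficient function u ↦ S_u (only u ∈ K^× matter)
  GA : Set
  GA = Carrier → Zζ

  _≈GA_ : GA → GA → Set
  S ≈GA T = ∀ u → ¬ (u ≡ 0#) → S u ≈ζ T u

  _⋆_ : GA → GA → GA
  (S ⋆ T) u = sumK× (λ v → S v ⊗ T (u * inv v))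

  _⊞_ : GA → GA → GA
  (S ⊞ T) u = S u ⊕ T u

  _⁽_⁾ : GA → ℕ → GA
  (S ⁽ t ⁾) w = sumK× (λ u → if does ((u ^ t) ≟ w) then S u else zeroζ)

  bar : GA → GA
  bar S w = sumK× (λ u → if does (inv u ≟ w) then conj (S u) else zeroζ)

  Kˣ : GA
  Kˣ _ = ζ^ 0

  Ψ : GA
  Ψ u = ψ u

  W : ℕ → GA
  W s = Wcoef s

{-# OPTIONS --safe #-}
-- Substituting x ↦ −x in W_u gives W_u = Σ_x ψ(ux − x^s), since (−x)^s = −x^s: (−1)^s squares
-- to 1, and (−1)^s = 1 would force −1 = ((−1)^s)^t = 1. The term x = 0 is the coefficient of K^×.
-- The coefficient of Ψ·\overline{Ψ^{(1/s)}} at u is Σ_{v ≠ 0} ψ(v)·\overline{ψ((v/u)^s)}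
-- = Σ_{v ≠ 0} ψ(v − (v/u)^s), which is the remaining sum after v = ux.
-- This uses that ψ = ζ^{Tr} is an additive character: Tr is additive by the Frobenius identity
-- (a + b)^p = a^p + b^p, and Tr x is fixed by Frobenius because x^q = x, so it is one of the
-- p roots 0, 1, …, p − 1 of y^p − y.
module Submission where

open import Defs
open import Level using (Level; 0ℓ)
open import Function using (id; _∘_; _⇔_; mk⇔; Equivalence)
open import Data.Bool using (Bool; true; false; if_then_else_)
open import Data.Empty using (⊥-elim)
open import Data.Sum using (_⊎_; inj₁; inj₂; [_,_])
open import Data.Product using (_,_; ∃; _×_; proj₂)
open import Data.Maybe using (Maybe; just; nothing)
open import Data.Sign as Sign using (Sign)
open import Data.Nat as ℕ using (ℕ; zero; suc; NonZero; _<_; _≤_; z≤n; s≤s)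
import Data.Nat.Properties as ℕ
open import Data.Nat.DivMod
  using ( _%_; _mod_; %-distribˡ-+; m%n%n≡m%n; m<n⇒m%n≡m; m%n<n; m%n≤n; [m+n]%n≡m%n
        ; m≡m%n+[m/n]*n; m/n*n≡m)
open import Data.Nat.Divisibility using (_∣_; divides; ∣⇒≤; ∣1⇒≡1; m∣m*n)
open import Data.Nat.Primality using (Prime; euclidsLemma; prime⇒nonZero; prime⇒nonTrivial)
open import Data.Nat.Coprimality using (Coprime; prime⇒coprime; coprime-Bézout)
open import Data.Nat.GCD using (module Bézout)
open import Data.Nat.Combinatorics using (_C_; nCn≡1; k![n∸k]!∣n!)
open import Data.Nat.Combinatorics.Specification using (nCk≡n!/k![n-k]!)
open import Data.Integer as ℤ using (ℤ; -[1+_]; _⊖_; _◃_; sign)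
import Data.Integer.Properties as ℤ
open import Data.Fin as Fin using (Fin; toℕ; fromℕ; inject₁)
import Data.Fin.Properties as Fin
open import Data.Vec.Functional using (init; replicate)
open import Data.List using (List; []; _∷_; _∷ʳ_; foldr; filter; map; length; upTo; applyUpTo; allFin)
open import Data.List.Properties using (foldr-map; length-applyUpTo; map-applyUpTo; upTo-∷ʳ)
open import Data.List.Membership.Propositional using (_∈_)
open import Data.List.Membership.Propositional.Properties
  using (∈-map⁺; ∈-map⁻; ∈-filter⁺; ∈-filter⁻; ∈-allFin; ∈-applyUpTo⁻; ∈-upTo⁺)
open import Data.List.Membership.Propositional.Properties.WithK using (unique∧set⇒bag)
open import Data.List.Relation.Unary.Any using (here; there)
open import Data.List.Relation.Unary.All as All using (All; []; _∷_; lookup)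
open import Data.List.Relation.Unary.AllPairs using (_∷_)
open import Data.List.Relation.Unary.Unique.Propositional using (Unique)
import Data.List.Relation.Unary.Unique.Propositional.Properties as Unique
open import Data.List.Relation.Binary.BagAndSetEquality using (∼bag⇒↭)
open import Data.List.Relation.Binary.Permutation.Propositional using (_↭_; ↭⇒↭ₛ′)
import Data.List.Relation.Binary.Permutation.Propositional.Properties as ↭
open import Relation.Nullary using (¬_; ¬?; yes; no; does)
open import Relation.Nullary.Decidable using (does-⇔)
open import Relation.Unary using (Pred; Decidable)
open import Relation.Binary.Definitions using (tri<; tri≈; tri>)
open import Relation.Binary.PropositionalEquality using (_≡_; _≢_; _≗_)
import Relation.Binary.PropositionalEquality as ≡
import Relation.Binary.Reasoning.Setoid
open import Algebra.Bundles using (CommutativeMonoid; CommutativeRing)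
open import Algebra.Solver.Ring.AlmostCommutativeRing using (fromCommutativeRing; _-Raw-AlmostCommutative⟶_)
import Algebra.Construct.Pointwise as Pointwise
import Algebra.Properties.Monoid.Sum
import Algebra.Properties.CommutativeSemiring.Binomial

-- The canonical map ℤ → R is a ring homomorphism, so the ring solver may be used over R
-- with integer coefficients, whose equality is decidable.
module IntegerCoefficients {c ℓ : Level} (R : CommutativeRing c ℓ) where
  open CommutativeRing R
  open import Algebra.Properties.Ring ring
    using (-‿distribˡ-*; -‿distribʳ-*; -‿involutive; -0#≈0#)
  open import Algebra.Properties.AbelianGroup +-abelianGroup using (⁻¹-∙-comm)
  open import Algebra.Properties.CommutativeSemigroup +-commutativeSemigroup
    using (interchange)
  open import Algebra.Definitions.RawMonoid +-rawMonoid using () renaming (_×_ to _×ᴿ_)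
  open import Algebra.Properties.Monoid.Mult +-monoid using (×-homo-+)
  open import Algebra.Properties.Semiring.Mult semiring using (×1-homo-*)
  open import Relation.Binary.Reasoning.Setoid setoid

  signed : Sign → Carrier → Carrier
  signed Sign.+ x = x
  signed Sign.- x = - x

  ⟦_⟧ℤ : ℤ → Carrier
  ⟦ i ⟧ℤ = signed (sign i) (ℤ.∣ i ∣ ×ᴿ 1#)

  signed-0# : ∀ s → signed s 0# ≈ 0#
  signed-0# Sign.+ = refl
  signed-0# Sign.- = -0#≈0#

  ◃-homo : ∀ s n → ⟦ s ◃ n ⟧ℤ ≈ signed s (n ×ᴿ 1#)
  ◃-homo s zero = sym (signed-0# s)
  ◃-homo Sign.+ (suc n) = refl
  ◃-homo Sign.- (suc n) = refl

  signed-* : ∀ s t x y → signed (s Sign.* t) (x * y) ≈ signed s x * signed t y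
  signed-* Sign.+ Sign.+ x y = refl
  signed-* Sign.+ Sign.- x y = -‿distribʳ-* x y
  signed-* Sign.- Sign.+ x y = -‿distribˡ-* x y
  signed-* Sign.- Sign.- x y = begin
    x * y         ≈⟨ -‿involutive (x * y) ⟨
    - - (x * y)   ≈⟨ -‿cong (-‿distribˡ-* x y) ⟩
    - (- x * y)   ≈⟨ -‿distribʳ-* (- x) y ⟩
    - x * - y     ∎

  signed-cong : ∀ s {x y} → x ≈ y → signed s x ≈ signed s y
  signed-cong Sign.+ x≈y = x≈y
  signed-cong Sign.- x≈y = -‿cong x≈y

  ⊖-homo : ∀ m n → ⟦ m ⊖ n ⟧ℤ ≈ m ×ᴿ 1# - n ×ᴿ 1#
  ⊖-homo zero zero = sym (trans (+-congˡ -0#≈0#) (+-identityˡ 0#))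
  ⊖-homo zero (suc n) = sym (+-identityˡ _)
  ⊖-homo (suc m) zero = sym (trans (+-congˡ -0#≈0#) (+-identityʳ _))
  ⊖-homo (suc m) (suc n) = begin
    ⟦ suc m ⊖ suc n ⟧ℤ                  ≡⟨ ≡.cong ⟦_⟧ℤ (ℤ.[1+m]⊖[1+n]≡m⊖n m n) ⟩
    ⟦ m ⊖ n ⟧ℤ                          ≈⟨ ⊖-homo m n ⟩
    m ×ᴿ 1# - n ×ᴿ 1#                   ≈⟨ +-identityˡ _ ⟨
    0# + (m ×ᴿ 1# - n ×ᴿ 1#)            ≈⟨ +-congʳ (-‿inverseʳ 1#) ⟨
    (1# - 1#) + (m ×ᴿ 1# - n ×ᴿ 1#)     ≈⟨ interchange 1# (- 1#) (m ×ᴿ 1#) (- (n ×ᴿ 1#)) ⟩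
    (1# + m ×ᴿ 1#) + (- 1# - n ×ᴿ 1#)   ≈⟨ +-congˡ (⁻¹-∙-comm 1# (n ×ᴿ 1#)) ⟩
    (1# + m ×ᴿ 1#) - (1# + n ×ᴿ 1#)     ∎

  +-homo : ∀ i j → ⟦ i ℤ.+ j ⟧ℤ ≈ ⟦ i ⟧ℤ + ⟦ j ⟧ℤ
  +-homo -[1+ m ] -[1+ n ] = begin
    - (suc (suc (m ℕ.+ n)) ×ᴿ 1#)     ≡⟨ ≡.cong (λ k → - (k ×ᴿ 1#)) (≡.sym (ℕ.+-suc (suc m) n)) ⟩
    - ((suc m ℕ.+ suc n) ×ᴿ 1#)       ≈⟨ -‿cong (×-homo-+ 1# (suc m) (suc n)) ⟩
    - (suc m ×ᴿ 1# + suc n ×ᴿ 1#)     ≈⟨ ⁻¹-∙-comm _ _ ⟨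
    - (suc m ×ᴿ 1#) - (suc n ×ᴿ 1#)   ∎
  +-homo -[1+ m ] (ℤ.+ n) = trans (⊖-homo n (suc m)) (+-comm _ _)
  +-homo (ℤ.+ m) -[1+ n ] = ⊖-homo m (suc n)
  +-homo (ℤ.+ m) (ℤ.+ n) = ×-homo-+ 1# m n

  *-homo : ∀ i j → ⟦ i ℤ.* j ⟧ℤ ≈ ⟦ i ⟧ℤ * ⟦ j ⟧ℤ
  *-homo i j = begin
    ⟦ i ℤ.* j ⟧ℤ                               ≈⟨ ◃-homo s (ℤ.∣ i ∣ ℕ.* ℤ.∣ j ∣) ⟩
    signed s ((ℤ.∣ i ∣ ℕ.* ℤ.∣ j ∣) ×ᴿ 1#)     ≈⟨ signed-cong s (×1-homo-* ℤ.∣ i ∣ ℤ.∣ j ∣) ⟩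
    signed s (ℤ.∣ i ∣ ×ᴿ 1# * ℤ.∣ j ∣ ×ᴿ 1#)   ≈⟨ signed-* (sign i) (sign j) _ _ ⟩
    ⟦ i ⟧ℤ * ⟦ j ⟧ℤ                            ∎
    where s = sign i Sign.* sign j

  -‿homo : ∀ i → ⟦ ℤ.- i ⟧ℤ ≈ - ⟦ i ⟧ℤ
  -‿homo -[1+ n ] = sym (-‿involutive _)
  -‿homo (ℤ.+ zero) = sym -0#≈0#
  -‿homo (ℤ.+ suc n) = refl

  ℤ⟶R : ℤ.+-*-rawRing -Raw-AlmostCommutative⟶ fromCommutativeRing R
  ℤ⟶R = record
    { ⟦_⟧ = ⟦_⟧ℤ ; +-homo = +-homo ; *-homo = *-homo ; -‿homo = -‿homo
    ; 0-homo = refl ; 1-homo = +-identityʳ 1# }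

  ⟦⟧ℤ-≟ : ∀ i j → Maybe (⟦ i ⟧ℤ ≈ ⟦ j ⟧ℤ)
  ⟦⟧ℤ-≟ i j with i ℤ.≟ j
  ... | yes ≡.refl = just refl
  ... | no _ = nothing

  open import Algebra.Solver.Ring ℤ.+-*-rawRing (fromCommutativeRing R) ℤ⟶R ⟦⟧ℤ-≟ public

private variable
  a : Level
  A X : Set a

↭-fromUnique : {xs ys : List A} → Unique xs → Unique ys → (∀ {z} → z ∈ xs ⇔ z ∈ ys) → xs ↭ ys
↭-fromUnique uxs uys same = ∼bag⇒↭ (unique∧set⇒bag uxs uys same)

map-↭ : ∀ (σ : A → A) {xs} → Unique xs → (∀ {x y} → σ x ≡ σ y → x ≡ y) →
        (∀ {x} → x ∈ xs → σ x ∈ xs) →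
        (∀ {y} → y ∈ xs → ∃ λ x → x ∈ xs × σ x ≡ y) →
        map σ xs ↭ xs
map-↭ σ uxs injective into onto = ↭-fromUnique (Unique.map⁺ injective uxs) uxs (mk⇔ to from)
  where
  to : ∀ {y} → y ∈ map σ _ → y ∈ _
  to y∈ with ∈-map⁻ σ y∈
  ... | x , x∈ , ≡.refl = into x∈
  from : ∀ {y} → y ∈ _ → y ∈ map σ _
  from y∈ with onto y∈
  ... | x , x∈ , ≡.refl = ∈-map⁺ σ x∈

module ListSum {c ℓ : Level} (M : CommutativeMonoid c ℓ) where
  open CommutativeMonoid M
  open import Data.List.Relation.Binary.Permutation.Setoid.Properties setoid
    using (foldr-commMonoid)
  open import Relation.Binary.Reasoning.Setoid setoid

  sum : (X → Carrier) → List X → Carrier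
  sum f xs = foldr (λ z acc → f z ∙ acc) ε xs

  sum-cong : ∀ {f g : X → Carrier} xs → (∀ {z} → z ∈ xs → f z ≈ g z) → sum f xs ≈ sum g xs
  sum-cong [] f≈g = refl
  sum-cong (z ∷ xs) f≈g = ∙-cong (f≈g (here ≡.refl)) (sum-cong xs (f≈g ∘ there))

  sum-map : ∀ {Y : Set a} (f : Y → Carrier) (g : X → Y) xs → sum f (map g xs) ≈ sum (f ∘ g) xs
  sum-map f g xs = reflexive (foldr-map _ g ε xs)

  sum-↭ : ∀ (f : X → Carrier) {xs ys} → xs ↭ ys → sum f xs ≈ sum f ys
  sum-↭ f {xs} {ys} xs↭ys = begin
    sum f xs                 ≈⟨ sum-map id f xs ⟨
    foldr _∙_ ε (map f xs)   ≈⟨ foldr-commMonoid isCommutativeMonoid map-f↭map-f ⟩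
    foldr _∙_ ε (map f ys)   ≈⟨ sum-map id f ys ⟩
    sum f ys                 ∎
    where map-f↭map-f = ↭⇒↭ₛ′ isEquivalence (↭.map⁺ f xs↭ys)

  sum-∙ : ∀ (f g : X → Carrier) xs → sum (λ z → f z ∙ g z) xs ≈ sum f xs ∙ sum g xs
  sum-∙ f g [] = sym (identityˡ ε)
  sum-∙ f g (z ∷ xs) = begin
    (f z ∙ g z) ∙ sum (λ z → f z ∙ g z) xs   ≈⟨ ∙-congˡ (sum-∙ f g xs) ⟩
    (f z ∙ g z) ∙ (sum f xs ∙ sum g xs)      ≈⟨ interchange (f z) (g z) (sum f xs) (sum g xs) ⟩
    (f z ∙ sum f xs) ∙ (g z ∙ sum g xs)      ∎
    where open import Algebra.Properties.CommutativeSemigroup commutativeSemigroup using (interchange)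

  sum-homo : ∀ (h : Carrier → Carrier) → h ε ≈ ε → (∀ a b → h (a ∙ b) ≈ h a ∙ h b) →
             ∀ (f : X → Carrier) xs → h (sum f xs) ≈ sum (h ∘ f) xs
  sum-homo h h-ε h-∙ f [] = h-ε
  sum-homo h h-ε h-∙ f (z ∷ xs) = trans (h-∙ (f z) (sum f xs)) (∙-congˡ (sum-homo h h-ε h-∙ f xs))

  sum-none : ∀ {p} {P : Pred X p} (P? : Decidable P) (f : X → Carrier) xs →
             (∀ {z} → z ∈ xs → ¬ P z) → sum (λ z → if does (P? z) then f z else ε) xs ≈ ε
  sum-none P? f [] none = refl
  sum-none P? f (z ∷ xs) none with P? z
  ... | yes Pz = ⊥-elim (none (here ≡.refl) Pz)
  ... | no _ = trans (identityˡ _) (sum-none P? f xs (none ∘ there))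

  sum-select : ∀ {p} {P : Pred X p} (P? : Decidable P) (f : X → Carrier) {xs w} →
               Unique xs → w ∈ xs → P w → (∀ {z} → z ∈ xs → P z → z ≡ w) →
               sum (λ z → if does (P? z) then f z else ε) xs ≈ f w
  sum-select P? f {w ∷ xs} (w∉xs ∷ _) (here ≡.refl) Pw only with P? w
  ... | no ¬Pw = ⊥-elim (¬Pw Pw)
  ... | yes _ =
    trans (∙-congˡ (sum-none P? f xs λ z∈xs Pz → lookup w∉xs z∈xs (≡.sym (only (there z∈xs) Pz))))
          (identityʳ _)
  sum-select P? f {z ∷ _} (z∉xs ∷ uxs) (there w∈xs) Pw only with P? z
  ... | yes Pz = ⊥-elim (lookup z∉xs w∈xs (only (here ≡.refl) Pz))
  ... | no _ = trans (identityˡ _) (sum-select P? f uxs w∈xs Pw (only ∘ there))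

module CyclotomicProperties (p : ℕ) .{{_ : NonZero p}} where
  open ≡ hiding ([_])
  open Cyclotomic p
  open import Data.Nat using (_+_; _∸_)
  open import Data.Nat.Properties using (+-comm; +-assoc)
  open import Algebra.Properties.CommutativeSemigroup ℕ.+-commutativeSemigroup
    using (xy∙z≈y∙xz; x∙yz≈y∙xz)

  +-congˡ-% : ∀ o {m n} → m % p ≡ n % p → (o + m) % p ≡ (o + n) % p
  +-congˡ-% o {m} {n} eq = begin
    (o + m) % p              ≡⟨ %-distribˡ-+ o m p ⟩
    (o % p + m % p) % p      ≡⟨ cong (λ k → (o % p + k) % p) eq ⟩
    (o % p + n % p) % p      ≡⟨ %-distribˡ-+ o n p ⟨
    (o + n) % p              ∎
    where open ≡-Reasoning

  +-congʳ-% : ∀ o {m n} → m % p ≡ n % p → (m + o) % p ≡ (n + o) % p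
  +-congʳ-% o {m} {n} eq = subst₂ (λ x y → x % p ≡ y % p) (+-comm o m) (+-comm o n) (+-congˡ-% o eq)

  +-complement-% : ∀ m → (m + (p ∸ m % p)) % p ≡ p % p
  +-complement-% m = begin
    (m + (p ∸ m % p)) % p       ≡⟨ +-congʳ-% (p ∸ m % p) (m%n%n≡m%n m p) ⟨
    (m % p + (p ∸ m % p)) % p   ≡⟨ cong (_% p) (ℕ.m+[n∸m]≡n (m%n≤n m p)) ⟩
    p % p                       ∎
    where open ≡-Reasoning

  +-absorbˡ-% : ∀ n {z} → z % p ≡ p % p → (n + z) % p ≡ n % p
  +-absorbˡ-% n z≡p = trans (+-congˡ-% n z≡p) ([m+n]%n≡m%n n p)

  toℕ-mod : ∀ m → toℕ (m mod p) ≡ m % p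
  toℕ-mod m = Fin.toℕ-fromℕ< (m%n<n m p)

  toℕ-% : ∀ (i : Fin p) → toℕ i % p ≡ toℕ i
  toℕ-% i = m<n⇒m%n≡m (Fin.toℕ<n i)

  δ : ℕ → ℕ → ℤ
  δ m n = if does (m % p ℕ.≟ n % p) then ℤ.1ℤ else ℤ.0ℤ

  δ-⇔ : ∀ {m n m′ n′} → (m % p ≡ n % p ⇔ m′ % p ≡ n′ % p) → δ m n ≡ δ m′ n′
  δ-⇔ {m} {n} {m′} {n′} eq =
    cong (if_then ℤ.1ℤ else ℤ.0ℤ) (does-⇔ eq (m % p ℕ.≟ n % p) (m′ % p ℕ.≟ n′ % p))

  ζ^-δ : ∀ k i → ζ^ k i ≡ δ (toℕ i) k
  ζ^-δ k i =
    cong (if_then ℤ.1ℤ else ℤ.0ℤ) (does-⇔ (mk⇔ to from) (toℕ i ℕ.≟ toℕ (k mod p)) (toℕ i % p ℕ.≟ k % p))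
    where
    to : toℕ i ≡ toℕ (k mod p) → toℕ i % p ≡ k % p
    to eq = trans (toℕ-% i) (trans eq (toℕ-mod k))
    from : toℕ i % p ≡ k % p → toℕ i ≡ toℕ (k mod p)
    from eq = trans (sym (toℕ-% i)) (trans eq (sym (toℕ-mod k)))

  δ-mod : ∀ m n → δ (toℕ (m mod p)) n ≡ δ m n
  δ-mod m n = δ-⇔ (mk⇔ (trans (sym mm)) (trans mm))
    where
    mm : toℕ (m mod p) % p ≡ m % p
    mm = trans (cong (_% p) (toℕ-mod m)) (m%n%n≡m%n m p)

  ζ^-cong : ∀ {m n} → m % p ≡ n % p → ζ^ m ≗ ζ^ n
  ζ^-cong {m} {n} eq i =
    trans (ζ^-δ m i) (trans (δ-⇔ (mk⇔ (λ e → trans e eq) (λ e → trans e (sym eq)))) (sym (ζ^-δ n i)))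

  module Σℤ = ListSum ℤ.+-0-commutativeMonoid

  indicator-* : ∀ (b : Bool) x → (if b then ℤ.1ℤ else ℤ.0ℤ) ℤ.* x ≡ (if b then x else ℤ.0ℤ)
  indicator-* true x = ℤ.*-identityˡ x
  indicator-* false x = refl

  ζ^-⊗-shift : ∀ a g i → (ζ^ a ⊗ g) i ≡ g ((toℕ i + (p ∸ toℕ (a mod p))) mod p)
  ζ^-⊗-shift a g i = begin
    (ζ^ a ⊗ g) i
      ≡⟨ Σℤ.sum-cong (allFin p) (λ {j} _ → indicator-* (does (toℕ j ℕ.≟ toℕ (a mod p))) (g (shift j))) ⟩
    Σℤ.sum (λ j → if does (toℕ j ℕ.≟ toℕ (a mod p)) then g (shift j) else ℤ.0ℤ) (allFin p)
      ≡⟨ Σℤ.sum-select (λ j → toℕ j ℕ.≟ toℕ (a mod p)) (g ∘ shift) (Unique.allFin⁺ p) (∈-allFin _) refl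
                       (λ _ → Fin.toℕ-injective) ⟩
    g (shift (a mod p)) ∎
    where
    open ≡-Reasoning
    shift : Fin p → Fin p
    shift j = (toℕ i + (p ∸ toℕ j)) mod p

  ζ^-⊗ : ∀ a b → ζ^ a ⊗ ζ^ b ≗ ζ^ (a + b)
  ζ^-⊗ a b i = begin
    (ζ^ a ⊗ ζ^ b) i                  ≡⟨ ζ^-⊗-shift a (ζ^ b) i ⟩
    ζ^ b ((t + (p ∸ toℕ (a mod p))) mod p)
      ≡⟨ trans (ζ^-δ b _) (δ-mod _ b) ⟩
    δ (t + (p ∸ toℕ (a mod p))) b    ≡⟨ cong (λ k → δ (t + (p ∸ k)) b) (toℕ-mod a) ⟩
    δ (t + r) b                      ≡⟨ δ-⇔ (mk⇔ to from) ⟩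
    δ t (a + b)                      ≡⟨ ζ^-δ (a + b) i ⟨
    ζ^ (a + b) i                     ∎
    where
    open ≡-Reasoning
    t = toℕ i
    r = p ∸ a % p
    to : (t + r) % p ≡ b % p → t % p ≡ (a + b) % p
    to e = begin
      t % p               ≡⟨ +-absorbˡ-% t (trans (cong (_% p) (+-comm r a)) (+-complement-% a)) ⟨
      (t + (r + a)) % p   ≡⟨ cong (_% p) (+-assoc t r a) ⟨
      (t + r + a) % p     ≡⟨ +-congʳ-% a e ⟩
      (b + a) % p         ≡⟨ cong (_% p) (+-comm b a) ⟩
      (a + b) % p         ∎
    from : t % p ≡ (a + b) % p → (t + r) % p ≡ b % p
    from e = begin
      (t + r) % p         ≡⟨ +-congʳ-% r e ⟩
      (a + b + r) % p     ≡⟨ cong (_% p) (xy∙z≈y∙xz a b r) ⟩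
      (b + (a + r)) % p   ≡⟨ +-absorbˡ-% b (+-complement-% a) ⟩
      b % p               ∎

  -- The hypothesis says b + c ≡ 0 (mod p); it is phrased with p % p because 0 % p does not
  -- reduce for a variable p.
  conj-ζ^ : ∀ {b c} → (b + c) % p ≡ p % p → conj (ζ^ b) ≗ ζ^ c
  conj-ζ^ {b} {c} b+c≡0 i = begin
    ζ^ b ((p ∸ t) mod p)   ≡⟨ trans (ζ^-δ b _) (δ-mod (p ∸ t) b) ⟩
    δ (p ∸ t) b            ≡⟨ δ-⇔ (mk⇔ to from) ⟩
    δ t c                  ≡⟨ ζ^-δ c i ⟨
    ζ^ c i                 ∎
    where
    open ≡-Reasoning
    t = toℕ i
    t≤p = ℕ.<⇒≤ (Fin.toℕ<n i)
    to : (p ∸ t) % p ≡ b % p → t % p ≡ c % p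
    to e = begin
      t % p                     ≡⟨ +-absorbˡ-% t b+c≡0 ⟨
      (t + (b + c)) % p         ≡⟨ +-congˡ-% t (+-congʳ-% c e) ⟨
      (t + (p ∸ t + c)) % p     ≡⟨ cong (_% p) (+-assoc t (p ∸ t) c) ⟨
      (t + (p ∸ t) + c) % p     ≡⟨ cong (λ k → (k + c) % p) (ℕ.m+[n∸m]≡n t≤p) ⟩
      (p + c) % p               ≡⟨ cong (_% p) (+-comm p c) ⟩
      (c + p) % p               ≡⟨ [m+n]%n≡m%n c p ⟩
      c % p                     ∎
    from : t % p ≡ c % p → (p ∸ t) % p ≡ b % p
    from e = begin
      (p ∸ t) % p               ≡⟨ +-absorbˡ-% (p ∸ t) b+c≡0 ⟨
      (p ∸ t + (b + c)) % p     ≡⟨ +-congˡ-% (p ∸ t) (+-congˡ-% b e) ⟨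
      (p ∸ t + (b + t)) % p     ≡⟨ cong (_% p) (x∙yz≈y∙xz (p ∸ t) b t) ⟩
      (b + (p ∸ t + t)) % p     ≡⟨ +-absorbˡ-% b (cong (_% p) (ℕ.m∸n+n≡m t≤p)) ⟩
      b % p                     ∎

  ⊗-congʳ : ∀ f {g h} → g ≗ h → f ⊗ g ≗ f ⊗ h
  ⊗-congʳ f g≗h i = Σℤ.sum-cong (allFin p) (λ {j} _ → cong (f j ℤ.*_) (g≗h _))

  conj-cong : ∀ {g h} → g ≗ h → conj g ≗ conj h
  conj-cong g≗h i = g≗h _

module FiniteFieldProperties (K : FiniteField) where
  open ≡ hiding ([_])
  open FiniteField K public

  commutativeRing : CommutativeRing 0ℓ 0ℓ
  commutativeRing = record { isCommutativeRing = isCommutativeRing }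

  open CommutativeRing commutativeRing public
    using ( _-_; +-assoc; +-comm; +-identityˡ; +-identityʳ; -‿inverseʳ
          ; *-assoc; *-comm; *-identityˡ; *-identityʳ; zeroˡ; zeroʳ
          ; +-commutativeMonoid; *-commutativeMonoid; commutativeSemiring; ring
          ; +-rawMonoid; +-monoid; +-group; semiring)
  open import Algebra.Properties.Ring ring public using (-‿involutive; -0#≈0#; -1*x≈-x)
  open import Algebra.Properties.Group +-group public
    using (x∙y⁻¹≈ε⇒x≈y; inverseˡ-unique) renaming (∙-cancelˡ to +-cancelˡ)
  open IntegerCoefficients commutativeRing public using (solve; _:+_; _:*_; _:-_; :-_; _:=_)
  open import Algebra.Definitions.RawMonoid +-rawMonoid public using () renaming (_×_ to _×ᴿ_)
  open import Algebra.Properties.Monoid.Mult +-monoid using (×-homo-+)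
  open import Algebra.Properties.Semiring.Mult semiring using (×1-homo-*; ×-assoc-*)
  open import Algebra.Properties.CommutativeSemiring.Exp commutativeSemiring
    using (^-assocʳ; ^-distrib-*)
  open import Algebra.Properties.CommutativeSemiring.Exp commutativeSemiring public
    using () renaming (_^_ to _^ᴿ_)

  module Σ+ = ListSum +-commutativeMonoid
  module Π* = ListSum *-commutativeMonoid

  headOr-filter : ∀ {A : Set} {P : Pred A 0ℓ} (P? : Decidable P) d {xs w} →
                  w ∈ xs → P w → P (headOr d (filter P? xs))
  headOr-filter P? d {x ∷ xs} w∈ Pw with P? x
  ... | yes Px = Px
  headOr-filter P? d {x ∷ xs} (here refl) Pw | no ¬Px = ⊥-elim (¬Px Pw)
  headOr-filter P? d {x ∷ xs} (there w∈) Pw | no _ = headOr-filter P? d w∈ Pw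

  1≢0 : 1# ≢ 0#
  1≢0 = 0≢1 ∘ sym

  inv-inverseʳ : ∀ {x} → x ≢ 0# → x * inv x ≡ 1#
  inv-inverseʳ {x} x≢0 = headOr-filter (λ y → (x * y) ≟ 1#) 0# (complete _) (proj₂ (inverse x x≢0))

  x*[x⁻¹*y]≡y : ∀ {x} y → x ≢ 0# → x * (inv x * y) ≡ y
  x*[x⁻¹*y]≡y {x} y x≢0 = begin
    x * (inv x * y)   ≡⟨ *-assoc x (inv x) y ⟨
    x * inv x * y     ≡⟨ cong (_* y) (inv-inverseʳ x≢0) ⟩
    1# * y            ≡⟨ *-identityˡ y ⟩
    y                 ∎
    where open ≡-Reasoning

  x⁻¹*[x*y]≡y : ∀ {x} y → x ≢ 0# → inv x * (x * y) ≡ y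
  x⁻¹*[x*y]≡y {x} y x≢0 = trans (solve 3 (λ x x⁻¹ y → x⁻¹ :* (x :* y) := x :* (x⁻¹ :* y)) refl x (inv x) y)
                                (x*[x⁻¹*y]≡y y x≢0)

  *-cancelˡ : ∀ {x} y z → x ≢ 0# → x * y ≡ x * z → y ≡ z
  *-cancelˡ {x} y z x≢0 xy≡xz =
    trans (sym (x⁻¹*[x*y]≡y y x≢0)) (trans (cong (inv x *_) xy≡xz) (x⁻¹*[x*y]≡y z x≢0))

  *-≡0 : ∀ {x y} → x * y ≡ 0# → x ≡ 0# ⊎ y ≡ 0#
  *-≡0 {x} {y} xy≡0 with x ≟ 0#
  ... | yes x≡0 = inj₁ x≡0
  ... | no x≢0 = inj₂ (*-cancelˡ y 0# x≢0 (trans xy≡0 (sym (zeroʳ x))))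

  x²≡1⇒x≡±1 : ∀ {x} → x * x ≡ 1# → x ≡ 1# ⊎ x ≡ - 1#
  x²≡1⇒x≡±1 {x} x²≡1 with *-≡0 [x-1][x+1]≡0
    where
    [x-1][x+1]≡0 : (x - 1#) * (x + 1#) ≡ 0#
    [x-1][x+1]≡0 = begin
      (x - 1#) * (x + 1#)     ≡⟨ solve 2 (λ x o → (x :- o) :* (x :+ o) := x :* x :- o :* o) refl x 1# ⟩
      x * x - 1# * 1#         ≡⟨ cong₂ _-_ x²≡1 (*-identityˡ 1#) ⟩
      1# - 1#                 ≡⟨ -‿inverseʳ 1# ⟩
      0#                      ∎
      where open ≡-Reasoning
  ... | inj₁ x-1≡0 = inj₁ (x∙y⁻¹≈ε⇒x≈y x 1# x-1≡0)
  ... | inj₂ x+1≡0 = inj₂ (inverseˡ-unique x 1# x+1≡0)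

  *-≢0 : ∀ {x y} → x ≢ 0# → y ≢ 0# → x * y ≢ 0#
  *-≢0 {x} {y} x≢0 y≢0 xy≡0 = [ x≢0 , y≢0 ] (*-≡0 xy≡0)

  inv-unique : ∀ {x y} → x * y ≡ 1# → inv x ≡ y
  inv-unique {x} {y} xy≡1 = *-cancelˡ (inv x) y x≢0 (trans (inv-inverseʳ x≢0) (sym xy≡1))
    where
    x≢0 : x ≢ 0#
    x≢0 x≡0 = 0≢1 (trans (sym (zeroˡ y)) (trans (cong (_* y) (sym x≡0)) xy≡1))

  inv-≢0 : ∀ {x} → x ≢ 0# → inv x ≢ 0#
  inv-≢0 {x} x≢0 x⁻¹≡0 = 0≢1 (trans (sym (zeroʳ x)) (trans (cong (x *_) (sym x⁻¹≡0)) (inv-inverseʳ x≢0)))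

  inv-involutive : ∀ {x} → x ≢ 0# → inv (inv x) ≡ x
  inv-involutive {x} x≢0 = inv-unique (trans (*-comm (inv x) x) (inv-inverseʳ x≢0))

  inv-distrib-* : ∀ {x y} → x ≢ 0# → y ≢ 0# → inv (x * y) ≡ inv x * inv y
  inv-distrib-* {x} {y} x≢0 y≢0 = inv-unique (begin
    x * y * (inv x * inv y)
      ≡⟨ solve 4 (λ x y x⁻¹ y⁻¹ → x :* y :* (x⁻¹ :* y⁻¹) := x :* x⁻¹ :* (y :* y⁻¹)) refl x y (inv x) (inv y) ⟩
    x * inv x * (y * inv y)       ≡⟨ cong₂ _*_ (inv-inverseʳ x≢0) (inv-inverseʳ y≢0) ⟩
    1# * 1#                       ≡⟨ *-identityˡ 1# ⟩
    1#                            ∎)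
    where open ≡-Reasoning

  ·1≡×ᴿ1 : ∀ n → n ·1 ≡ n ×ᴿ 1#
  ·1≡×ᴿ1 zero = refl
  ·1≡×ᴿ1 (suc n) = cong (1# +_) (·1≡×ᴿ1 n)

  ·1-+ : ∀ m n → (m ℕ.+ n) ·1 ≡ m ·1 + n ·1
  ·1-+ m n = begin
    (m ℕ.+ n) ·1          ≡⟨ ·1≡×ᴿ1 (m ℕ.+ n) ⟩
    (m ℕ.+ n) ×ᴿ 1#        ≡⟨ ×-homo-+ 1# m n ⟩
    m ×ᴿ 1# + n ×ᴿ 1#       ≡⟨ cong₂ _+_ (·1≡×ᴿ1 m) (·1≡×ᴿ1 n) ⟨
    m ·1 + n ·1           ∎
    where open ≡-Reasoning

  ·1-* : ∀ m n → (m ℕ.* n) ·1 ≡ m ·1 * n ·1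
  ·1-* m n = begin
    (m ℕ.* n) ·1          ≡⟨ ·1≡×ᴿ1 (m ℕ.* n) ⟩
    (m ℕ.* n) ×ᴿ 1#        ≡⟨ ×1-homo-* m n ⟩
    m ×ᴿ 1# * n ×ᴿ 1#       ≡⟨ cong₂ _*_ (·1≡×ᴿ1 m) (·1≡×ᴿ1 n) ⟨
    m ·1 * n ·1           ∎
    where open ≡-Reasoning

  ×ᴿ≡·1* : ∀ n x → n ×ᴿ x ≡ n ·1 * x
  ×ᴿ≡·1* n x = begin
    n ×ᴿ x                 ≡⟨ cong (n ×ᴿ_) (*-identityˡ x) ⟨
    n ×ᴿ (1# * x)          ≡⟨ ×-assoc-* n 1# x ⟨
    n ×ᴿ 1# * x            ≡⟨ cong (_* x) (·1≡×ᴿ1 n) ⟨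
    n ·1 * x              ∎
    where open ≡-Reasoning

  ^≡^ᴿ : ∀ x n → x ^ n ≡ x ^ᴿ n
  ^≡^ᴿ x zero = refl
  ^≡^ᴿ x (suc n) = cong (x *_) (^≡^ᴿ x n)

  ^-* : ∀ x m n → x ^ (m ℕ.* n) ≡ (x ^ m) ^ n
  ^-* x m n = begin
    x ^ (m ℕ.* n)     ≡⟨ ^≡^ᴿ x (m ℕ.* n) ⟩
    x ^ᴿ (m ℕ.* n)    ≡⟨ ^-assocʳ x m n ⟨
    (x ^ᴿ m) ^ᴿ n     ≡⟨ cong (_^ᴿ n) (^≡^ᴿ x m) ⟨
    (x ^ m) ^ᴿ n      ≡⟨ ^≡^ᴿ (x ^ m) n ⟨
    (x ^ m) ^ n       ∎
    where open ≡-Reasoning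

  ^-distribʳ-* : ∀ x y n → (x * y) ^ n ≡ x ^ n * y ^ n
  ^-distribʳ-* x y n = begin
    (x * y) ^ n       ≡⟨ ^≡^ᴿ (x * y) n ⟩
    (x * y) ^ᴿ n      ≡⟨ ^-distrib-* x y n ⟩
    x ^ᴿ n * y ^ᴿ n   ≡⟨ cong₂ _*_ (^≡^ᴿ x n) (^≡^ᴿ y n) ⟨
    x ^ n * y ^ n     ∎
    where open ≡-Reasoning

  1^n≡1 : ∀ n → 1# ^ n ≡ 1#
  1^n≡1 zero = refl
  1^n≡1 (suc n) = trans (*-identityˡ _) (1^n≡1 n)

  0^n≡0 : ∀ n .{{_ : ℕ.NonZero n}} → 0# ^ n ≡ 0#
  0^n≡0 (suc n) = zeroˡ _

  ^-≢0 : ∀ {x} n → x ≢ 0# → x ^ n ≢ 0#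
  ^-≢0 zero x≢0 = 1≢0
  ^-≢0 (suc n) x≢0 = *-≢0 x≢0 (^-≢0 n x≢0)

  ∈-units⇔ : ∀ {x} → x ∈ units ⇔ x ≢ 0#
  ∈-units⇔ = mk⇔ (proj₂ ∘ ∈-filter⁻ (λ x → ¬? (x ≟ 0#)) {xs = elements})
                 (∈-filter⁺ (λ x → ¬? (x ≟ 0#)) (complete _))

  ∈-units⁻ : ∀ {x} → x ∈ units → x ≢ 0#
  ∈-units⁻ = Equivalence.to ∈-units⇔

  ∈-units⁺ : ∀ {x} → x ≢ 0# → x ∈ units
  ∈-units⁺ = Equivalence.from ∈-units⇔

  units-unique : Unique units
  units-unique = Unique.filter⁺ (λ x → ¬? (x ≟ 0#)) unique

  elements↭0∷units : elements ↭ 0# ∷ units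
  elements↭0∷units = ↭-fromUnique unique (0∉units ∷ units-unique) (mk⇔ to (λ _ → complete _))
    where
    0∉units : All (0# ≢_) units
    0∉units = All.tabulate (λ x∈ 0≡x → ∈-units⁻ x∈ (sym 0≡x))
    to : ∀ {x} → x ∈ elements → x ∈ 0# ∷ units
    to {x} _ with x ≟ 0#
    ... | yes refl = here refl
    ... | no x≢0 = there (∈-units⁺ x≢0)

  order≡1+|units| : order ≡ suc (length units)
  order≡1+|units| = ↭.↭-length elements↭0∷units

  -‿injective : ∀ {x y} → - x ≡ - y → x ≡ y
  -‿injective {x} {y} -x≡-y = trans (sym (-‿involutive x)) (trans (cong -_ -x≡-y) (-‿involutive y))

  -1≢0 : - 1# ≢ 0#
  -1≢0 -1≡0 = 1≢0 (-‿injective (trans -1≡0 (sym -0#≈0#)))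

  neg-elements↭elements : map -_ elements ↭ elements
  neg-elements↭elements =
    map-↭ -_ unique -‿injective (λ _ → complete _) (λ {y} _ → - y , complete _ , -‿involutive y)

  scale-units↭units : ∀ {w} → w ≢ 0# → map (w *_) units ↭ units
  scale-units↭units {w} w≢0 = map-↭ (w *_) units-unique (*-cancelˡ _ _ w≢0)
    (λ x∈ → ∈-units⁺ (*-≢0 w≢0 (∈-units⁻ x∈)))
    (λ {y} y∈ → inv w * y , ∈-units⁺ (*-≢0 (inv-≢0 w≢0) (∈-units⁻ y∈)) , x*[x⁻¹*y]≡y y w≢0)

  ∏-const : ∀ {A : Set} x (xs : List A) → Π*.sum (λ _ → x) xs ≡ x ^ length xs
  ∏-const x [] = refl
  ∏-const x (_ ∷ xs) = cong (x *_) (∏-const x xs)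

  ∏-≢0 : ∀ {xs} → (∀ {x} → x ∈ xs → x ≢ 0#) → Π*.sum (λ x → x) xs ≢ 0#
  ∏-≢0 {[]} _ = 1≢0
  ∏-≢0 {x ∷ xs} nonzero = *-≢0 (nonzero (here refl)) (∏-≢0 (nonzero ∘ there))

  fermat : ∀ {x} → x ≢ 0# → x ^ (order ℕ.∸ 1) ≡ 1#
  fermat {x} x≢0 = *-cancelˡ (x ^ (order ℕ.∸ 1)) 1# (∏-≢0 ∈-units⁻) (begin
    ∏ units * x ^ (order ℕ.∸ 1)                  ≡⟨ cong (λ n → ∏ units * x ^ (n ℕ.∸ 1)) order≡1+|units| ⟩
    ∏ units * x ^ length units                   ≡⟨ cong (∏ units *_) (∏-const x units) ⟨
    ∏ units * Π*.sum (λ _ → x) units             ≡⟨ *-comm _ _ ⟩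
    Π*.sum (λ _ → x) units * ∏ units             ≡⟨ Π*.sum-∙ (λ _ → x) (λ u → u) units ⟨
    Π*.sum (x *_) units                          ≡⟨ Π*.sum-map (λ u → u) (x *_) units ⟨
    ∏ (map (x *_) units)                         ≡⟨ Π*.sum-↭ (λ u → u) (scale-units↭units x≢0) ⟩
    ∏ units                                      ≡⟨ *-identityʳ _ ⟨
    ∏ units * 1#                                 ∎)
    where
    open ≡-Reasoning
    ∏ : List Carrier → Carrier
    ∏ = Π*.sum (λ u → u)

  fermat-all : ∀ x → x ^ order ≡ x
  fermat-all x with x ≟ 0#
  ... | yes refl = subst (λ n → 0# ^ n ≡ 0#) (sym order≡1+|units|) (zeroˡ _)
  ... | no x≢0 = begin
    x ^ order                       ≡⟨ cong (x ^_) order≡1+|units| ⟩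
    x * x ^ length units            ≡⟨ cong (λ n → x * x ^ (n ℕ.∸ 1)) order≡1+|units| ⟨
    x * x ^ (order ℕ.∸ 1)           ≡⟨ cong (x *_) (fermat x≢0) ⟩
    x * 1#                          ≡⟨ *-identityʳ x ⟩
    x                               ∎
    where open ≡-Reasoning

  multiple-·1≡0 : ∀ {d} → d ·1 ≡ 0# → ∀ m → (m ℕ.* d) ·1 ≡ 0#
  multiple-·1≡0 {d} d·1≡0 m = trans (·1-* m d) (trans (cong (m ·1 *_) d·1≡0) (zeroʳ _))

  ·1≡0⇒suc≢ : ∀ {a b} → a ·1 ≡ 0# → b ·1 ≡ 0# → suc a ≢ b
  ·1≡0⇒suc≢ {a} {b} a·1≡0 b·1≡0 1+a≡b = 1≢0 (begin
    1#            ≡⟨ +-identityʳ 1# ⟨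
    1# + 0#       ≡⟨ cong (1# +_) a·1≡0 ⟨
    suc a ·1      ≡⟨ cong _·1 1+a≡b ⟩
    b ·1          ≡⟨ b·1≡0 ⟩
    0#            ∎)
    where open ≡-Reasoning

  module Binomial = Algebra.Properties.CommutativeSemiring.Binomial commutativeSemiring
  module VecSum = Algebra.Properties.Monoid.Sum (CommutativeRing.+-monoid commutativeRing)

  binomials·1≡0⇒^-distrib-+ : ∀ m → (∀ {k} → 0 < k → k < suc m → (suc m C k) ·1 ≡ 0#) →
                                     ∀ a b → (a + b) ^ suc m ≡ a ^ suc m + b ^ suc m
  binomials·1≡0⇒^-distrib-+ m C≡0 a b = begin
    (a + b) ^ suc m                                     ≡⟨ ^≡^ᴿ (a + b) (suc m) ⟩
    (a + b) ^ᴿ suc m                                    ≡⟨ Binomial.theorem (suc m) a b ⟩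
    t Fin.zero + VecSum.sum (t ∘ Fin.suc)
      ≡⟨ cong (t Fin.zero +_) (VecSum.sum-init-last (t ∘ Fin.suc)) ⟩
    t Fin.zero + (VecSum.sum (init (t ∘ Fin.suc)) + t (Fin.suc (fromℕ m)))
      ≡⟨ cong₂ (λ u v → u + (v + t (Fin.suc (fromℕ m)))) first-term middle-terms ⟩
    b ^ suc m + (0# + t (Fin.suc (fromℕ m)))
      ≡⟨ cong (b ^ suc m +_) (trans (+-identityˡ _) last-term) ⟩
    b ^ suc m + a ^ suc m                               ≡⟨ +-comm _ _ ⟩
    a ^ suc m + b ^ suc m                               ∎
    where
    open ≡-Reasoning
    t = Binomial.binomialTerm a b (suc m)
    first-term : t Fin.zero ≡ b ^ suc m
    first-term = trans (+-identityʳ _) (trans (*-identityˡ _) (sym (^≡^ᴿ b (suc m))))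
    middle-terms : VecSum.sum (init (t ∘ Fin.suc)) ≡ 0#
    middle-terms = trans (VecSum.sum-cong-≋ {m} vanish) (VecSum.sum-replicate-zero m)
      where
      vanish : ∀ j → t (Fin.suc (inject₁ j)) ≡ replicate m 0# j
      vanish j = begin
        t (Fin.suc (inject₁ j))                     ≡⟨ ×ᴿ≡·1* (suc m C k) _ ⟩
        (suc m C k) ·1 * term                       ≡⟨ cong (_* term) (C≡0 (s≤s z≤n) (s≤s (Fin.inject₁ℕ< j))) ⟩
        0# * term                                   ≡⟨ zeroˡ term ⟩
        0#                                          ∎
        where
        k = suc (toℕ (inject₁ j))
        term = Binomial.binomial a b (suc m) (Fin.suc (inject₁ j))
    last-term : t (Fin.suc (fromℕ m)) ≡ a ^ suc m
    last-term = begin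
      t (Fin.suc (fromℕ m))
        ≡⟨ cong (λ i → (suc m C suc i) ×ᴿ (a ^ᴿ suc i * b ^ᴿ (m ℕ.∸ i))) (Fin.toℕ-fromℕ m) ⟩
      ((suc m C suc m) ×ᴿ (a ^ᴿ suc m * b ^ᴿ (m ℕ.∸ m)))
        ≡⟨ cong₂ (λ c e → c ×ᴿ (a ^ᴿ suc m * b ^ᴿ e)) (nCn≡1 (suc m)) (ℕ.n∸n≡0 m) ⟩
      a ^ᴿ suc m * 1# + 0#     ≡⟨ trans (+-identityʳ _) (*-identityʳ _) ⟩
      a ^ᴿ suc m               ≡⟨ ^≡^ᴿ a (suc m) ⟨
      a ^ suc m                ∎

  -- IsPolynomial ℓ m f: the function f is a polynomial of formal degree m with leading
  -- coefficient ℓ, presented by Horner's scheme.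
  data IsPolynomial (ℓ : Carrier) : ℕ → (Carrier → Carrier) → Set where
    constant : ∀ {f} → (∀ y → f y ≡ ℓ) → IsPolynomial ℓ zero f
    horner : ∀ {m f g} c → IsPolynomial ℓ m g → (∀ y → f y ≡ c + y * g y) → IsPolynomial ℓ (suc m) f

  factor-theorem : ∀ {ℓ m f} → IsPolynomial ℓ (suc m) f → ∀ a →
                   ∃ λ q → IsPolynomial ℓ m q × (∀ y → f y ≡ f a + (y - a) * q y)
  factor-theorem {f = f} (horner {g = g} c (constant g≡ℓ) f≡c+yg) a = g , constant g≡ℓ , λ y → begin
    f y                             ≡⟨ f≡c+yg y ⟩
    c + y * g y                     ≡⟨ cong (λ z → c + y * z) (trans (g≡ℓ y) (sym (g≡ℓ a))) ⟩
    c + y * g a                     ≡⟨ solve 4 (λ c y a G → c :+ y :* G := c :+ a :* G :+ (y :- a) :* G)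
                                               refl c y a (g a) ⟩
    (c + a * g a) + (y - a) * g a   ≡⟨ cong₂ (λ u v → u + (y - a) * v) (f≡c+yg a) (trans (g≡ℓ y) (sym (g≡ℓ a))) ⟨
    f a + (y - a) * g y             ∎
    where open ≡-Reasoning
  factor-theorem {f = f} (horner {g = g} c g-poly@(horner _ _ _) f≡c+yg) a with factor-theorem g-poly a
  ... | h , h-poly , g≡ga+[y-a]h = (λ y → g a + y * h y) , horner (g a) h-poly (λ _ → refl) , λ y → begin
    f y                                         ≡⟨ f≡c+yg y ⟩
    c + y * g y                                 ≡⟨ cong (λ z → c + y * z) (g≡ga+[y-a]h y) ⟩
    c + y * (g a + (y - a) * h y)
      ≡⟨ solve 5 (λ c y a G H → c :+ y :* (G :+ (y :- a) :* H) := c :+ a :* G :+ (y :- a) :* (G :+ y :* H))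
               refl c y a (g a) (h y) ⟩
    (c + a * g a) + (y - a) * (g a + y * h y)   ≡⟨ cong (_+ (y - a) * (g a + y * h y)) (f≡c+yg a) ⟨
    f a + (y - a) * (g a + y * h y)             ∎
    where open ≡-Reasoning

  factor-at-root : ∀ {ℓ m f} → IsPolynomial ℓ (suc m) f → ∀ {a} → f a ≡ 0# →
                   ∃ λ q → IsPolynomial ℓ m q × (∀ y → f y ≡ (y - a) * q y)
  factor-at-root f-poly {a} fa≡0 with factor-theorem f-poly a
  ... | q , q-poly , f≡fa+[y-a]q =
    q , q-poly , λ y → trans (f≡fa+[y-a]q y) (trans (cong (_+ (y - a) * q y) fa≡0) (+-identityˡ _))

  roots-complete : ∀ {ℓ m f} → ℓ ≢ 0# → IsPolynomial ℓ m f → ∀ {rs} → length rs ≡ m → Unique rs →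
                   (∀ {r} → r ∈ rs → f r ≡ 0#) → ∀ {y} → f y ≡ 0# → y ∈ rs
  roots-complete ℓ≢0 (constant f≡ℓ) _ _ _ {y} fy≡0 = ⊥-elim (ℓ≢0 (trans (sym (f≡ℓ y)) fy≡0))
  roots-complete ℓ≢0 f-poly@(horner _ _ _) {a ∷ rs} |rs|≡m (a∉rs ∷ rs-unique) f≡0 {y} fy≡0
    with factor-at-root f-poly (f≡0 (here refl))
  ... | q , q-poly , f≡[y-a]q with *-≡0 (trans (sym (f≡[y-a]q y)) fy≡0)
  ... | inj₁ y-a≡0 = here (x∙y⁻¹≈ε⇒x≈y y a y-a≡0)
  ... | inj₂ qy≡0 = there (roots-complete ℓ≢0 q-poly (ℕ.suc-injective |rs|≡m) rs-unique q≡0 qy≡0)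
    where
    q≡0 : ∀ {r} → r ∈ rs → q r ≡ 0#
    q≡0 {r} r∈rs with *-≡0 (trans (sym (f≡[y-a]q r)) (f≡0 (there r∈rs)))
    ... | inj₁ r-a≡0 = ⊥-elim (lookup a∉rs r∈rs (sym (x∙y⁻¹≈ε⇒x≈y r a r-a≡0)))
    ... | inj₂ qr≡0 = qr≡0

  x^m-poly : ∀ m → IsPolynomial 1# m (_^ m)
  x^m-poly zero = constant (λ _ → refl)
  x^m-poly (suc m) = horner 0# (x^m-poly m) (λ _ → sym (+-identityˡ _))

  x^[2+m]-x-poly : ∀ m → IsPolynomial 1# (2 ℕ.+ m) (λ y → y ^ (2 ℕ.+ m) - y)
  x^[2+m]-x-poly m = horner 0# (horner (- 1#) (x^m-poly m) inner) outer
    where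
    inner : ∀ y → y ^ suc m - 1# ≡ - 1# + y * y ^ m
    inner y = solve 3 (λ y w o → y :* w :- o := :- o :+ y :* w) refl y (y ^ m) 1#
    outer : ∀ y → y ^ (2 ℕ.+ m) - y ≡ 0# + y * (y ^ suc m - 1#)
    outer y = begin
      y * y ^ suc m - y               ≡⟨ cong (λ z → y * y ^ suc m - z) (*-identityʳ y) ⟨
      y * y ^ suc m - y * 1#          ≡⟨ solve 3 (λ y w o → y :* w :- y :* o := y :* (w :- o)) refl y (y ^ suc m) 1# ⟩
      y * (y ^ suc m - 1#)            ≡⟨ +-identityˡ _ ⟨
      0# + y * (y ^ suc m - 1#)       ∎
      where open ≡-Reasoning

module _ {p} (p-prime : Prime p) where
  open ≡ hiding ([_])

  p∤m! : ∀ {m} → m < p → ¬ p ∣ m ℕ.!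
  p∤m! {zero} _ p∣1 = ℕ.nonTrivial⇒≢1 {{prime⇒nonTrivial p-prime}} (∣1⇒≡1 p∣1)
  p∤m! {suc m} m<p p∣m! with euclidsLemma (suc m) (m ℕ.!) p-prime p∣m!
  ... | inj₁ p∣1+m = ℕ.<⇒≱ m<p (∣⇒≤ p∣1+m)
  ... | inj₂ p∣m! = p∤m! (ℕ.<-trans (ℕ.n<1+n m) m<p) p∣m!

  p∣pCk : ∀ {k} → 0 < k → k < p → p ∣ p C k
  p∣pCk {k} 0<k k<p with euclidsLemma (p C k) (k ℕ.! ℕ.* (p ℕ.∸ k) ℕ.!) p-prime p∣pCk*k![p∸k]!
    where
    instance _ = prime⇒nonZero p-prime
    k≤p = ℕ.<⇒≤ k<p
    p∣pCk*k![p∸k]! : p ∣ (p C k) ℕ.* (k ℕ.! ℕ.* (p ℕ.∸ k) ℕ.!)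
    p∣pCk*k![p∸k]! = subst (p ∣_) (sym pCk*k![p∸k]!≡p!) p∣p!
      where
      instance _ = ℕ._!*_!≢0 k (p ℕ.∸ k)
      pCk*k![p∸k]!≡p! : (p C k) ℕ.* (k ℕ.! ℕ.* (p ℕ.∸ k) ℕ.!) ≡ p ℕ.!
      pCk*k![p∸k]!≡p! =
        trans (cong (ℕ._* (k ℕ.! ℕ.* (p ℕ.∸ k) ℕ.!)) (nCk≡n!/k![n-k]! k≤p)) (m/n*n≡m (k![n∸k]!∣n! k≤p))
      p∣p! : p ∣ p ℕ.!
      p∣p! = subst (λ n → n ∣ n ℕ.!) (ℕ.suc-pred p) (m∣m*n (ℕ.pred p ℕ.!))
  ... | inj₁ p∣pCk = p∣pCk
  ... | inj₂ p∣k!*[p∸k]! with euclidsLemma (k ℕ.!) ((p ℕ.∸ k) ℕ.!) p-prime p∣k!*[p∸k]!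
  ...   | inj₁ p∣k! = ⊥-elim (p∤m! k<p p∣k!)
  ...   | inj₂ p∣[p∸k]! = ⊥-elim (p∤m! (ℕ.∸-monoʳ-< 0<k (ℕ.<⇒≤ k<p)) p∣[p∸k]!)

module CharacteristicP
  (K : FiniteField) (p : ℕ) (p-prime : Prime p) (char : FiniteField._·1 K p ≡ FiniteField.0# K) where
  open ≡ hiding ([_])
  open FiniteFieldProperties K

  instance
    p≢0 : NonZero p
    p≢0 = prime⇒nonZero p-prime

  ·1-mod : ∀ m → m ·1 ≡ (m % p) ·1
  ·1-mod m = begin
    m ·1                                     ≡⟨ cong _·1 (m≡m%n+[m/n]*n m p) ⟩
    (m % p ℕ.+ (m ℕ./ p) ℕ.* p) ·1           ≡⟨ ·1-+ (m % p) _ ⟩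
    (m % p) ·1 + ((m ℕ./ p) ℕ.* p) ·1        ≡⟨ cong ((m % p) ·1 +_) (multiple-·1≡0 char (m ℕ./ p)) ⟩
    (m % p) ·1 + 0#                          ≡⟨ +-identityʳ _ ⟩
    (m % p) ·1                               ∎
    where open ≡-Reasoning

  ·1-≢0 : ∀ {d} → 0 < d → d < p → d ·1 ≢ 0#
  ·1-≢0 {d} 0<d d<p d·1≡0 with coprime-Bézout (prime⇒coprime p-prime {{ℕ.>-nonZero 0<d}} d<p)
  ... | Bézout.+- x y 1+yd≡xp = ·1≡0⇒suc≢ (multiple-·1≡0 d·1≡0 y) (multiple-·1≡0 char x) 1+yd≡xp
  ... | Bézout.-+ x y 1+xp≡yd = ·1≡0⇒suc≢ (multiple-·1≡0 char x) (multiple-·1≡0 d·1≡0 y) 1+xp≡yd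

  ·1-∸ : ∀ {j k} → j ≤ k → (k ℕ.∸ j) ·1 ≡ k ·1 - j ·1
  ·1-∸ {j} {k} j≤k = begin
    (k ℕ.∸ j) ·1                    ≡⟨ solve 2 (λ x y → y := x :+ y :- x) refl (j ·1) _ ⟩
    j ·1 + (k ℕ.∸ j) ·1 - j ·1      ≡⟨ cong (_- j ·1) (·1-+ j (k ℕ.∸ j)) ⟨
    (j ℕ.+ (k ℕ.∸ j)) ·1 - j ·1     ≡⟨ cong (λ n → n ·1 - j ·1) (ℕ.m+[n∸m]≡n j≤k) ⟩
    k ·1 - j ·1                     ∎
    where open ≡-Reasoning

  ·1-injective-< : ∀ {j k} → j < k → k < p → j ·1 ≢ k ·1
  ·1-injective-< {j} {k} j<k k<p j·1≡k·1 =
    ·1-≢0 (ℕ.m<n⇒0<n∸m j<k) (ℕ.≤-<-trans (ℕ.m∸n≤m k j) k<p) (begin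
    (k ℕ.∸ j) ·1      ≡⟨ ·1-∸ (ℕ.<⇒≤ j<k) ⟩
    k ·1 - j ·1       ≡⟨ cong (k ·1 -_) j·1≡k·1 ⟩
    k ·1 - k ·1       ≡⟨ -‿inverseʳ (k ·1) ⟩
    0#                ∎)
    where open ≡-Reasoning

  ·1-injective : ∀ {j k} → j < p → k < p → j ·1 ≡ k ·1 → j ≡ k
  ·1-injective {j} {k} j<p k<p j·1≡k·1 with ℕ.<-cmp j k
  ... | tri< j<k _ _ = ⊥-elim (·1-injective-< j<k k<p j·1≡k·1)
  ... | tri≈ _ j≡k _ = j≡k
  ... | tri> _ _ k<j = ⊥-elim (·1-injective-< k<j j<p (sym j·1≡k·1))

  ·1-≡⇒%-≡ : ∀ {m n} → m ·1 ≡ n ·1 → m % p ≡ n % p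
  ·1-≡⇒%-≡ {m} {n} m·1≡n·1 =
    ·1-injective (m%n<n m p) (m%n<n n p) (trans (sym (·1-mod m)) (trans m·1≡n·1 (·1-mod n)))

  frobenius : ∀ a b → (a + b) ^ p ≡ a ^ p + b ^ p
  frobenius a b = subst (λ n → (a + b) ^ n ≡ a ^ n + b ^ n) (ℕ.suc-pred p)
                        (binomials·1≡0⇒^-distrib-+ (ℕ.pred p) pCk·1≡0 a b)
    where
    pCk·1≡0 : ∀ {k} → 0 < k → k < suc (ℕ.pred p) → (suc (ℕ.pred p) C k) ·1 ≡ 0#
    pCk·1≡0 {k} 0<k k<p with p∣pCk p-prime 0<k (subst (k <_) (ℕ.suc-pred p) k<p)
    ... | divides q pCk≡qp = begin
      (suc (ℕ.pred p) C k) ·1    ≡⟨ cong (λ n → (n C k) ·1) (ℕ.suc-pred p) ⟩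
      (p C k) ·1                 ≡⟨ cong _·1 pCk≡qp ⟩
      (q ℕ.* p) ·1               ≡⟨ multiple-·1≡0 char q ⟩
      0#                         ∎
      where open ≡-Reasoning

  ^-p^suc : ∀ x i → x ^ (p ℕ.^ suc i) ≡ (x ^ (p ℕ.^ i)) ^ p
  ^-p^suc x i = trans (cong (x ^_) (ℕ.*-comm p (p ℕ.^ i))) (^-* x (p ℕ.^ i) p)

  frobenius-iterate : ∀ i a b → (a + b) ^ (p ℕ.^ i) ≡ a ^ (p ℕ.^ i) + b ^ (p ℕ.^ i)
  frobenius-iterate zero a b = trans (*-identityʳ _) (sym (cong₂ _+_ (*-identityʳ a) (*-identityʳ b)))
  frobenius-iterate (suc i) a b = begin
    (a + b) ^ (p ℕ.^ suc i)                       ≡⟨ ^-p^suc (a + b) i ⟩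
    ((a + b) ^ (p ℕ.^ i)) ^ p                     ≡⟨ cong (_^ p) (frobenius-iterate i a b) ⟩
    (a ^ (p ℕ.^ i) + b ^ (p ℕ.^ i)) ^ p           ≡⟨ frobenius _ _ ⟩
    (a ^ (p ℕ.^ i)) ^ p + (b ^ (p ℕ.^ i)) ^ p     ≡⟨ cong₂ _+_ (^-p^suc a i) (^-p^suc b i) ⟨
    a ^ (p ℕ.^ suc i) + b ^ (p ℕ.^ suc i)         ∎
    where open ≡-Reasoning

  ·1^p≡·1 : ∀ k → (k ·1) ^ p ≡ k ·1
  ·1^p≡·1 zero = 0^n≡0 p
  ·1^p≡·1 (suc k) = trans (frobenius 1# (k ·1)) (cong₂ _+_ (1^n≡1 p) (·1^p≡·1 k))

  x^p-x-poly : IsPolynomial 1# p (λ y → y ^ p - y)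
  x^p-x-poly = subst (λ n → IsPolynomial 1# n (λ y → y ^ n - y))
                     (ℕ.m+[n∸m]≡n (ℕ.nonTrivial⇒n>1 p {{prime⇒nonTrivial p-prime}}))
                     (x^[2+m]-x-poly (p ℕ.∸ 2))

  primeField : List Carrier
  primeField = applyUpTo _·1 p

  frobenius-fixed⇒∈primeField : ∀ {y} → y ^ p ≡ y → y ∈ primeField
  frobenius-fixed⇒∈primeField {y} y^p≡y =
    roots-complete 1≢0 x^p-x-poly (length-applyUpTo _·1 p)
                   (Unique.applyUpTo⁺₁ _·1 p ·1-injective-<) root (trans (cong (_- y) y^p≡y) (-‿inverseʳ y))
    where
    root : ∀ {r} → r ∈ primeField → r ^ p - r ≡ 0#
    root r∈ with ∈-applyUpTo⁻ _·1 r∈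
    ... | i , _ , refl = trans (cong (_- i ·1) (·1^p≡·1 i)) (-‿inverseʳ (i ·1))

module TraceProperties
  (K : FiniteField) (p : ℕ) (p-prime : Prime p) (char : FiniteField._·1 K p ≡ FiniteField.0# K)
  (n : ℕ) (order≡p^n : FiniteField.order K ≡ p ℕ.^ n) where
  open ≡ hiding ([_])
  open FiniteFieldProperties K
  open CharacteristicP K p p-prime char
  open Setup K p n
  open CyclotomicProperties p

  Tr-+ : ∀ a b → Tr (a + b) ≡ Tr a + Tr b
  Tr-+ a b = trans (Σ+.sum-cong (upTo n) (λ {i} _ → frobenius-iterate i a b))
                   (Σ+.sum-∙ (λ i → a ^ (p ℕ.^ i)) (λ i → b ^ (p ℕ.^ i)) (upTo n))

  Tr-0 : Tr 0# ≡ 0#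
  Tr-0 = +-cancelˡ (Tr 0#) (Tr 0#) 0# (begin
    Tr 0# + Tr 0#       ≡⟨ Tr-+ 0# 0# ⟨
    Tr (0# + 0#)        ≡⟨ cong Tr (+-identityʳ 0#) ⟩
    Tr 0#               ≡⟨ +-identityʳ (Tr 0#) ⟨
    Tr 0# + 0#          ∎)
    where open ≡-Reasoning

  frobenius-sum : ∀ {A : Set} (f : A → Carrier) xs → Σ+.sum f xs ^ p ≡ Σ+.sum (λ i → f i ^ p) xs
  frobenius-sum = Σ+.sum-homo (_^ p) (0^n≡0 p) frobenius

  Tr^p≡Tr : ∀ x → Tr x ^ p ≡ Tr x
  Tr^p≡Tr x = +-cancelˡ x (Tr x ^ p) (Tr x) (begin
    x + Tr x ^ p                            ≡⟨ cong₂ _+_ (sym (*-identityʳ x)) (frobenius-sum f (upTo n)) ⟩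
    f 0 + Σ+.sum (λ i → f i ^ p) (upTo n)   ≡⟨ cong (f 0 +_) (Σ+.sum-cong (upTo n) (λ {i} _ → ^-p^suc x i)) ⟨
    f 0 + Σ+.sum (f ∘ suc) (upTo n)         ≡⟨ cong (f 0 +_) (Σ+.sum-map f suc (upTo n)) ⟨
    f 0 + Σ+.sum f (map suc (upTo n))       ≡⟨ cong (λ is → f 0 + Σ+.sum f is) (map-applyUpTo id suc n) ⟩
    Σ+.sum f (upTo (suc n))                 ≡⟨ cong (Σ+.sum f) (upTo-∷ʳ n) ⟨
    Σ+.sum f (upTo n ∷ʳ n)                  ≡⟨ Σ+.sum-↭ f (↭.∷↭∷ʳ n (upTo n)) ⟨
    f n + Tr x                              ≡⟨ cong (λ m → x ^ m + Tr x) order≡p^n ⟨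
    x ^ order + Tr x                        ≡⟨ cong (_+ Tr x) (fermat-all x) ⟩
    x + Tr x                                ∎)
    where
    open ≡-Reasoning
    f : ℕ → Carrier
    f i = x ^ (p ℕ.^ i)

  -- Tr x lies in the prime field, so the search defining trℕ x does not fall back to its default 0.
  trℕ-·1 : ∀ x → trℕ x ·1 ≡ Tr x
  trℕ-·1 x with ∈-applyUpTo⁻ _·1 (frobenius-fixed⇒∈primeField (Tr^p≡Tr x))
  ... | k , k<p , Tr≡k·1 = headOr-filter (λ k → (k ·1) ≟ Tr x) 0 (∈-upTo⁺ k<p) (sym Tr≡k·1)

  trℕ-+ : ∀ a b → trℕ (a + b) % p ≡ (trℕ a ℕ.+ trℕ b) % p
  trℕ-+ a b = ·1-≡⇒%-≡ (begin
    trℕ (a + b) ·1             ≡⟨ trℕ-·1 (a + b) ⟩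
    Tr (a + b)                 ≡⟨ Tr-+ a b ⟩
    Tr a + Tr b                ≡⟨ cong₂ _+_ (trℕ-·1 a) (trℕ-·1 b) ⟨
    trℕ a ·1 + trℕ b ·1        ≡⟨ ·1-+ (trℕ a) (trℕ b) ⟨
    (trℕ a ℕ.+ trℕ b) ·1       ∎)
    where open ≡-Reasoning

  trℕ-0 : trℕ 0# % p ≡ 0 % p
  trℕ-0 = ·1-≡⇒%-≡ (trans (trℕ-·1 0#) Tr-0)

  ψ-0 : ψ 0# ≗ ζ^ 0
  ψ-0 = ζ^-cong trℕ-0

  ψ-+ : ∀ a b → ψ a ⊗ ψ b ≗ ψ (a + b)
  ψ-+ a b i = trans (ζ^-⊗ (trℕ a) (trℕ b) i) (ζ^-cong (sym (trℕ-+ a b)) i)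

  conj-ψ : ∀ y → conj (ψ y) ≗ ψ (- y)
  conj-ψ y = conj-ζ^ (begin
    (trℕ y ℕ.+ trℕ (- y)) % p    ≡⟨ trℕ-+ y (- y) ⟨
    trℕ (y - y) % p              ≡⟨ cong (λ z → trℕ z % p) (-‿inverseʳ y) ⟩
    trℕ 0# % p                   ≡⟨ trℕ-0 ⟩
    0 % p                        ≡⟨ ·1-≡⇒%-≡ char ⟨
    p % p                        ∎)
    where open ≡-Reasoning

module GroupAlgebraIdentity
  (K : FiniteField) (p : ℕ) (p-prime : Prime p) (char : FiniteField._·1 K p ≡ FiniteField.0# K)
  (n : ℕ) (order≡p^n : FiniteField.order K ≡ p ℕ.^ n)
  (s t k : ℕ) (0<s : 0 < s) (st≡1+k[q-1] : s ℕ.* t ≡ 1 ℕ.+ k ℕ.* (FiniteField.order K ℕ.∸ 1)) where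
  open ≡ hiding ([_])
  open FiniteFieldProperties K
  open CharacteristicP K p p-prime char using (p≢0)
  open TraceProperties K p p-prime char n order≡p^n
  open Setup K p n
  open CyclotomicProperties p using (⊗-congʳ; conj-cong)

  ℤζ-commutativeMonoid : CommutativeMonoid 0ℓ 0ℓ
  ℤζ-commutativeMonoid = Pointwise.commutativeMonoid (Fin p) ℤ.+-0-commutativeMonoid

  module Σζ = ListSum ℤζ-commutativeMonoid
  module ≗-Reasoning = Relation.Binary.Reasoning.Setoid (CommutativeMonoid.setoid ℤζ-commutativeMonoid)

  ^st≡id : ∀ {u} → u ≢ 0# → u ^ (s ℕ.* t) ≡ u
  ^st≡id {u} u≢0 = begin
    u ^ (s ℕ.* t)                         ≡⟨ cong (u ^_) st≡1+k[q-1] ⟩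
    u * u ^ (k ℕ.* (order ℕ.∸ 1))         ≡⟨ cong (λ m → u * u ^ m) (ℕ.*-comm k (order ℕ.∸ 1)) ⟩
    u * u ^ ((order ℕ.∸ 1) ℕ.* k)         ≡⟨ cong (u *_) (^-* u (order ℕ.∸ 1) k) ⟩
    u * (u ^ (order ℕ.∸ 1)) ^ k           ≡⟨ cong (λ z → u * z ^ k) (fermat u≢0) ⟩
    u * 1# ^ k                            ≡⟨ cong (u *_) (1^n≡1 k) ⟩
    u * 1#                                ≡⟨ *-identityʳ u ⟩
    u                                     ∎
    where open ≡-Reasoning

  ^s^t≡id : ∀ {u} → u ≢ 0# → (u ^ s) ^ t ≡ u
  ^s^t≡id {u} u≢0 = trans (sym (^-* u s t)) (^st≡id u≢0)

  ^t^s≡id : ∀ {u} → u ≢ 0# → (u ^ t) ^ s ≡ u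
  ^t^s≡id {u} u≢0 = trans (sym (^-* u t s)) (trans (cong (u ^_) (ℕ.*-comm t s)) (^st≡id u≢0))

  -1^s≡-1 : (- 1#) ^ s ≡ - 1#
  -1^s≡-1 with x²≡1⇒x≡±1 [-1^s]²≡1
    where
    [-1^s]²≡1 : (- 1#) ^ s * (- 1#) ^ s ≡ 1#
    [-1^s]²≡1 = begin
      (- 1#) ^ s * (- 1#) ^ s     ≡⟨ ^-distribʳ-* (- 1#) (- 1#) s ⟨
      (- 1# * - 1#) ^ s           ≡⟨ cong (_^ s) (solve 1 (λ o → :- o :* :- o := o :* o) refl 1#) ⟩
      (1# * 1#) ^ s               ≡⟨ cong (_^ s) (*-identityˡ 1#) ⟩
      1# ^ s                      ≡⟨ 1^n≡1 s ⟩
      1#                          ∎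
      where open ≡-Reasoning
  ... | inj₂ -1^s≡-1 = -1^s≡-1
  ... | inj₁ -1^s≡1 = trans -1^s≡1 (sym -1≡1)
    where
    -1≡1 : - 1# ≡ 1#
    -1≡1 = trans (sym (^s^t≡id -1≢0)) (trans (cong (_^ t) -1^s≡1) (1^n≡1 t))

  -x^s≡-[x^s] : ∀ x → (- x) ^ s ≡ - (x ^ s)
  -x^s≡-[x^s] x = begin
    (- x) ^ s                   ≡⟨ cong (_^ s) (-1*x≈-x x) ⟨
    (- 1# * x) ^ s              ≡⟨ ^-distribʳ-* (- 1#) x s ⟩
    (- 1#) ^ s * x ^ s          ≡⟨ cong (_* x ^ s) -1^s≡-1 ⟩
    - 1# * x ^ s                ≡⟨ -1*x≈-x (x ^ s) ⟩
    - (x ^ s)                   ∎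
    where open ≡-Reasoning

  ⁽t⁾-coefficient : ∀ S {w} → w ≢ 0# → (S ⁽ t ⁾) w ≗ S (w ^ s)
  ⁽t⁾-coefficient S {w} w≢0 =
    Σζ.sum-select (λ u → (u ^ t) ≟ w) S units-unique (∈-units⁺ (^-≢0 s w≢0)) (^s^t≡id w≢0)
      (λ u∈ u^t≡w → trans (sym (^t^s≡id (∈-units⁻ u∈))) (cong (_^ s) u^t≡w))

  bar-coefficient : ∀ S {w} → w ≢ 0# → bar S w ≗ conj (S (inv w))
  bar-coefficient S {w} w≢0 =
    Σζ.sum-select (λ u → inv u ≟ w) (conj ∘ S) units-unique (∈-units⁺ (inv-≢0 w≢0)) (inv-involutive w≢0)
      (λ u∈ u⁻¹≡w → trans (sym (inv-involutive (∈-units⁻ u∈))) (cong inv u⁻¹≡w))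

  [w*v⁻¹]⁻¹≡v*w⁻¹ : ∀ {v w} → v ≢ 0# → w ≢ 0# → inv (w * inv v) ≡ v * inv w
  [w*v⁻¹]⁻¹≡v*w⁻¹ {v} {w} v≢0 w≢0 =
    trans (inv-distrib-* w≢0 (inv-≢0 v≢0)) (trans (cong (inv w *_) (inv-involutive v≢0)) (*-comm (inv w) v))

  product-term : ∀ {v w} → v ≢ 0# → w ≢ 0# → ψ v ⊗ bar (Ψ ⁽ t ⁾) (w * inv v) ≗ ψ (v - (v * inv w) ^ s)
  product-term {v} {w} v≢0 w≢0 = begin
    ψ v ⊗ bar (Ψ ⁽ t ⁾) (w * inv v)
      ≈⟨ ⊗-congʳ (ψ v) (bar-coefficient (Ψ ⁽ t ⁾) wv⁻¹≢0) ⟩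
    ψ v ⊗ conj ((Ψ ⁽ t ⁾) (inv (w * inv v)))
      ≈⟨ ⊗-congʳ (ψ v) (conj-cong (⁽t⁾-coefficient Ψ (inv-≢0 wv⁻¹≢0))) ⟩
    ψ v ⊗ conj (ψ (inv (w * inv v) ^ s))
      ≡⟨ cong (λ z → ψ v ⊗ conj (ψ (z ^ s))) ([w*v⁻¹]⁻¹≡v*w⁻¹ v≢0 w≢0) ⟩
    ψ v ⊗ conj (ψ y)                 ≈⟨ ⊗-congʳ (ψ v) (conj-ψ y) ⟩
    ψ v ⊗ ψ (- y)                    ≈⟨ ψ-+ v (- y) ⟩
    ψ (v - y)                        ∎
    where
    open ≗-Reasoning
    y = (v * inv w) ^ s
    wv⁻¹≢0 = *-≢0 w≢0 (inv-≢0 v≢0)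

  W-expansion : ∀ w → W s w ≗ ψ 0# ⊕ Σζ.sum (λ x → ψ (w * x - x ^ s)) units
  W-expansion w = begin
    Σζ.sum g elements                                 ≈⟨ Σζ.sum-↭ g neg-elements↭elements ⟨
    Σζ.sum g (map -_ elements)                        ≈⟨ Σζ.sum-map g -_ elements ⟩
    Σζ.sum (λ x → ψ ((- x) ^ s - w * - x)) elements
      ≈⟨ Σζ.sum-cong elements (λ {x} _ i → cong (λ z → ψ z i) (negated x)) ⟩
    Σζ.sum f elements                                 ≈⟨ Σζ.sum-↭ f elements↭0∷units ⟩
    f 0# ⊕ Σζ.sum f units                             ≡⟨ cong (λ z → ψ z ⊕ Σζ.sum f units) f-at-0 ⟩
    ψ 0# ⊕ Σζ.sum f units                             ∎
    where
    open ≗-Reasoning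
    f g : Carrier → Zζ
    f x = ψ (w * x - x ^ s)
    g x = ψ (x ^ s - w * x)
    negated : ∀ x → (- x) ^ s - w * - x ≡ w * x - x ^ s
    negated x = trans (cong (_- w * - x) (-x^s≡-[x^s] x))
                      (solve 3 (λ x w xˢ → :- xˢ :- w :* :- x := w :* x :- xˢ) refl x w (x ^ s))
    f-at-0 : w * 0# - 0# ^ s ≡ 0#
    f-at-0 = trans (cong₂ _-_ (zeroʳ w) (0^n≡0 s {{ℕ.>-nonZero 0<s}})) (-‿inverseʳ 0#)

  product-expansion : ∀ {w} → w ≢ 0# → (Ψ ⋆ bar (Ψ ⁽ t ⁾)) w ≗ Σζ.sum (λ x → ψ (w * x - x ^ s)) units
  product-expansion {w} w≢0 = begin
    Σζ.sum (λ v → ψ v ⊗ bar (Ψ ⁽ t ⁾) (w * inv v)) units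
      ≈⟨ Σζ.sum-cong units (λ v∈ → product-term (∈-units⁻ v∈) w≢0) ⟩
    Σζ.sum h units                            ≈⟨ Σζ.sum-↭ h (scale-units↭units w≢0) ⟨
    Σζ.sum h (map (w *_) units)               ≈⟨ Σζ.sum-map h (w *_) units ⟩
    Σζ.sum (h ∘ (w *_)) units
      ≈⟨ Σζ.sum-cong units (λ {x} _ i → cong (λ z → ψ (w * x - z ^ s) i) (wx/w≡x x)) ⟩
    Σζ.sum (λ x → ψ (w * x - x ^ s)) units    ∎
    where
    open ≗-Reasoning
    h : Carrier → Zζ
    h v = ψ (v - (v * inv w) ^ s)
    wx/w≡x : ∀ x → w * x * inv w ≡ x
    wx/w≡x x = trans (solve 3 (λ w x w⁻¹ → w :* x :* w⁻¹ := w :* (w⁻¹ :* x)) refl w x (inv w))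
                     (x*[x⁻¹*y]≡y x w≢0)

  W≈Ψ⋆bar[Ψ⁽t⁾]⊞Kˣ : W s ≈GA ((Ψ ⋆ bar (Ψ ⁽ t ⁾)) ⊞ Kˣ)
  W≈Ψ⋆bar[Ψ⁽t⁾]⊞Kˣ w w≢0 = ℤ.0ℤ , λ i → begin
    W s w i                                             ≡⟨ W-expansion w i ⟩
    ψ 0# i ℤ.+ Σζ.sum f units i                         ≡⟨ cong₂ ℤ._+_ (ψ-0 i) (sym (product-expansion w≢0 i)) ⟩
    ζ^ 0 i ℤ.+ (Ψ ⋆ bar (Ψ ⁽ t ⁾)) w i                  ≡⟨ ℤ.+-comm (ζ^ 0 i) _ ⟩
    (Ψ ⋆ bar (Ψ ⁽ t ⁾)) w i ℤ.+ ζ^ 0 i                  ≡⟨ ℤ.+-identityʳ _ ⟨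
    (Ψ ⋆ bar (Ψ ⁽ t ⁾)) w i ℤ.+ ζ^ 0 i ℤ.+ ℤ.0ℤ         ∎
    where
    open ≡-Reasoning
    f : Carrier → Zζ
    f x = ψ (w * x - x ^ s)

open import Data.Nat using (_*_; _+_; _^_; _∸_)

lemma5p5 : (K : FiniteField) (p : ℕ) .{{_ : NonZero p}} → Prime p
    → FiniteField._·1 K p ≡ FiniteField.0# K
    → (n : ℕ) → FiniteField.order K ≡ p ^ n
    → (s : ℕ) → 0 < s → Coprime s (FiniteField.order K ∸ 1)
    → (t : ℕ) → (∃ λ k → s * t ≡ 1 + k * (FiniteField.order K ∸ 1))
    → Setup._≈GA_ K p n (Setup.W K p n s)
        (Setup._⊞_ K p n (Setup._⋆_ K p n (Setup.Ψ K p n) (Setup.bar K p n (Setup._⁽_⁾ K p n (Setup.Ψ K p n) t))) (Setup.Kˣ K p n))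
lemma5p5 K p p-prime char n order≡p^n s 0<s _ t (k , st≡1+k[q-1]) =
  GroupAlgebraIdentity.W≈Ψ⋆bar[Ψ⁽t⁾]⊞Kˣ K p p-prime char n order≡p^n s t k 0<s st≡1+k[q-1]
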